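{- Let $n,r,s$ be integers with $n,r,s \geq 4$, $n \geq 2r$ and $r \geq s+1$. If there exists a hypergraph $\mathcal{H}$ with vertex set $[n]$ such that $\chi\left(\mathrm{KG}^r(\mathcal{H}_{s\text{ -stable}})\right) = 0$ and $\left\lceil \frac{\mathrm{cd}^r(\mathcal{H})}{r-1} \right\rceil = 1$, then $r \in \left\{s+1, s+2, \dots, s + \left\lceil \frac{s-3}{2} \right\rceil\right\}$.
   Context: $[n]=\{1,\dots,n\}$. A hypergraph $\mathcal{H}$ on vertex set $V$ is a family $E(\mathcal{H})$ of nonempty subsets of $V$ (hyperedges). A set $S \subseteq [n]$ is $s$-stable if any two distinct $i,j \in S$ satisfy $s \leq |i-j| \leq n-s$. For a hypergraph $\mathcal{H}$ on $[n]$, $\mathcal{H}_{s\text{ -stable}}$ denotes the hypergraph on $[n]$ whose hyperedges are the $s$-stable hyperedges of $\mathcal{H}$. For a hypergraph $\mathcal{F}$ and $r\ge 2$, the general Kneser hypergraph $\mathrm{KG}^r(\mathcal{F})$ has vertex set $E(\mathcal{F})$, and its hyperedges are the sets of $r$ pairwise disjoint hyperedges of $\mathcal{F}$. The chromatic number $\chi$ of a hypergraph is the least number of colors in a vertex coloring with no monochromatic hyperedge (it is $0$ when the vertex set is empty). The $r$-colorability defect $\mathrm{cd}^r(\mathcal{H})$ is the minimum size of a set $S \subseteq V(\mathcal{H})$ such that the induced subhypergraph on $V(\mathcal{H})\setminus S$ (whose hyperedges are the hyperedges of $\mathcal{H}$ contained in $V(\mathcal{H})\setminus S$) admits a vertex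 coloring with at most $r$ colors having no monochromatic hyperedge. -}

module Defs where

open import Data.Nat using (ℕ; zero; suc; _+_; _*_; _∸_; _≤_; _<_; ∣_-_∣; _/_)
open import Data.Bool using (Bool; T)
open import Data.Fin using (Fin; toℕ)
open import Data.Fin.Subset using (Subset; _∈_; _∩_; ∁; _⊆_; ∣_∣; Empty; Nonempty)
open import Data.Product using (Σ; ∃; _×_; _,_; proj₁)
open import Relation.Nullary using (¬_)
open import Relation.Binary.PropositionalEquality using (_≡_; _≢_)

-- A hypergraph on vertex set [n] (represented as Fin n, 0-based; only
-- differences of indices matter): a family of subsets of [n], given by its
-- characteristic (Bool-valued) predicate.
Hypergraph : ℕ → Set
Hypergraph n = Subset n → Bool

IsHypergraph : {n : ℕ} → Hypergraph n → Set
IsHypergraph {n} H = (e : Subset n) → T (H e) → Nonempty e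

Family : ℕ → Set₁
Family n = Subset n → Set

edgesOf : {n : ℕ} → Hypergraph n → Family n
edgesOf H e = T (H e)

IsStable : (n s : ℕ) → Subset n → Set
IsStable n s S = (i j : Fin n) → i ∈ S → j ∈ S → i ≢ j →
  (s ≤ ∣ toℕ i - toℕ j ∣) × (∣ toℕ i - toℕ j ∣ ≤ n ∸ s)

stablePart : {n : ℕ} → ℕ → Hypergraph n → Family n
stablePart {n} s H e = T (H e) × IsStable n s e

Disjoint : {n : ℕ} → Subset n → Subset n → Set
Disjoint A B = Empty (A ∩ B)

KGVertex : {n : ℕ} → Family n → Set
KGVertex {n} F = Σ (Subset n) F

-- A hyperedge of KG^r(F) on which the coloring c is monochromatic:
-- r pairwise disjoint (hence, being nonempty, distinct) hyperedges of F,
-- all receiving the same color.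
MonoKGEdge : {n k : ℕ} (r : ℕ) (F : Family n) → (KGVertex F → Fin k) → Set
MonoKGEdge r F c =
  ∃ λ (f : Fin r → KGVertex F) →
    ((i j : Fin r) → i ≢ j → Disjoint (proj₁ (f i)) (proj₁ (f j))) ×
    ((i j : Fin r) → c (f i) ≡ c (f j))

KGColorable : {n : ℕ} (r : ℕ) (F : Family n) (k : ℕ) → Set
KGColorable r F k = ∃ λ (c : KGVertex F → Fin _) → ¬ MonoKGEdge {k = k} r F c

KGChromaticNumber : {n : ℕ} (r : ℕ) (F : Family n) (k : ℕ) → Set
KGChromaticNumber r F k =
  KGColorable r F k × ((j : ℕ) → j < k → ¬ KGColorable r F j)

Monochromatic : {n k : ℕ} → (Fin n → Fin k) → Subset n → Set
Monochromatic {n} c e = (i j : Fin n) → i ∈ e → j ∈ e → c i ≡ c j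

-- After deleting S, the induced subhypergraph of H on [n] \ S (hyperedges of
-- H contained in [n] \ S) admits a proper coloring with at most r colors.
-- (Colors of vertices in S are irrelevant.)
RemovalColorable : {n : ℕ} (r : ℕ) → Hypergraph n → Subset n → Set
RemovalColorable {n} r H S =
  ∃ λ (c : Fin n → Fin r) →
    (e : Subset n) → T (H e) → e ⊆ ∁ S → ¬ Monochromatic c e

ColorabilityDefect : {n : ℕ} (r : ℕ) → Hypergraph n → ℕ → Set
ColorabilityDefect {n} r H m =
  (∃ λ (S : Subset n) → (∣ S ∣ ≡ m) × RemovalColorable r H S) ×
  ((S : Subset n) → RemovalColorable r H S → m ≤ ∣ S ∣)

ceilDivSuc : ℕ → ℕ → ℕ
ceilDivSuc a b = (a + b) / suc b

{-# OPTIONS --safe #-}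
module Submission where

open import Defs
open import Data.Nat using (ℕ; suc; _+_; _*_; _∸_; _≤_; ⌈_/2⌉)
open import Data.Product using (∃; _×_)
open import Relation.Binary.PropositionalEquality using (_≡_)

open import Data.Nat using (_<_; z≤n; s≤s; _<?_; _≤?_; ∣_-_∣; ⌊_/2⌋)
open import Data.Nat.Properties
open import Data.Nat.DivMod using (m<n⇒m/n≡0)
open import Data.Nat.Induction using (<-wellFounded)
open import Data.Nat.ListAction using (sum)
open import Algebra.Properties.CommutativeSemigroup +-commutativeSemigroup using (interchange; x∙yz≈y∙xz; xy∙z≈xz∙y)
open import Data.Fin using (Fin; toℕ; fromℕ<)
open import Data.Fin.Properties using (¬Fin0; toℕ-fromℕ<; toℕ<n; toℕ-injective)
open import Data.Fin.Subset using (⊥)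
open import Data.Fin.Subset.Properties using (∣⊥∣≡0)
open import Data.List using (List; []; _∷_)
open import Data.List.Relation.Unary.All using (All; []; _∷_)
open import Data.Product as Product using (_,_; proj₁; proj₂)
open import Induction.WellFounded using (Acc; acc)
open import Relation.Binary using (tri<; tri≈; tri>)
open import Relation.Binary.PropositionalEquality using (_≢_; refl; module ≡-Reasoning; sym; trans; cong; subst)
open import Relation.Nullary using (¬_; yes; no; contradiction)

-- If r exceeds the bound then 3s ≤ 2r + 1, and the cycle [n] can be cut into
-- arcs whose lengths lie between s and r (two halves if n ≤ 2r; otherwise cut
-- off an arc of length s, leaving at least 3s - s = 2s).  Colouring each vertex
-- by its position inside its arc uses r colours, and two vertices of the same
-- colour sit at the same position of different arcs, hence at cyclic distance
-- at least s.  So every monochromatic set is s-stable; as χ = 0 says that H has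
-- no s-stable hyperedge at all, this is a proper r-colouring of H, i.e.
-- cd^r(H) = 0, contradicting ⌈cd^r(H)/(r-1)⌉ = 1.

-- Ls lists the lengths of consecutive blocks starting at 0; offset Ls j is the
-- position of j inside its block.
offset : List ℕ → ℕ → ℕ
offset []       j = j
offset (L ∷ Ls) j with j <? L
... | yes _ = j
... | no  _ = offset Ls (j ∸ L)

offset-inside : ∀ {L j} Ls → j < L → offset (L ∷ Ls) j ≡ j
offset-inside {L} {j} Ls j<L with j <? L
... | yes _   = refl
... | no  j≮L = contradiction j<L j≮L

offset-beyond : ∀ L Ls j → offset (L ∷ Ls) (L + j) ≡ offset Ls j
offset-beyond L Ls j with L + j <? L
... | yes L+j<L = contradiction L+j<L (m+n≮m L j)
... | no  _     = cong (offset Ls) (m+n∸m≡n L j)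

data BlockPosition (L : ℕ) : ℕ → Set where
  inside : ∀ {j} → j < L → BlockPosition L j
  beyond : ∀ j → BlockPosition L (L + j)

blockPosition : ∀ L j → BlockPosition L j
blockPosition L j with j <? L
... | yes j<L = inside j<L
... | no  j≮L with m≤n⇒∃[o]m+o≡n (≮⇒≥ j≮L)
...   | k , refl = beyond k

offset-< : ∀ {r} Ls {j} → All (_≤ r) Ls → j < sum Ls → offset Ls j < r
offset-< (L ∷ Ls) {j} (L≤r ∷ Ls≤r) j<sum with blockPosition L j
... | inside j<L rewrite offset-inside Ls j<L = <-≤-trans j<L L≤r
... | beyond k   rewrite offset-beyond L Ls k =
  offset-< Ls Ls≤r (+-cancelˡ-< L k (sum Ls) j<sum)

offset-blockStart : ∀ {s} Ls {j} → All (s ≤_) Ls → j < sum Ls →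
  ∃ λ b → b + offset Ls j ≡ j × b + s ≤ sum Ls
offset-blockStart {s} (L ∷ Ls) {j} (s≤L ∷ s≤Ls) j<sum with blockPosition L j
... | inside j<L = 0 , offset-inside Ls j<L , ≤-trans s≤L (m≤m+n L (sum Ls))
... | beyond k with offset-blockStart Ls s≤Ls (+-cancelˡ-< L k (sum Ls) j<sum)
...   | b , b+o≡k , b+s≤ = L + b , start , end
  where
  start : L + b + offset (L ∷ Ls) (L + k) ≡ L + k
  start rewrite offset-beyond L Ls k | +-assoc L b (offset Ls k) = cong (L +_) b+o≡k
  end : L + b + s ≤ L + sum Ls
  end rewrite +-assoc L b s = +-monoʳ-≤ L b+s≤

≡offset⇒separated : ∀ {s} Ls {x y} → All (s ≤_) Ls → x < y → y < sum Ls →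
  offset Ls x ≡ offset Ls y → s + x ≤ y × y + s ≤ sum Ls + x
≡offset⇒separated {s} (L ∷ Ls) {x} {y} (s≤L ∷ s≤Ls) x<y y<sum eq
  with blockPosition L x | blockPosition L y
... | inside x<L | inside y<L =
  contradiction (trans (sym (offset-inside Ls x<L)) (trans eq (offset-inside Ls y<L))) (<⇒≢ x<y)
... | beyond x′ | inside y<L = contradiction (<-trans x<y y<L) (m+n≮m L x′)
... | inside x<L | beyond y′ =
  crossing (trans (sym (offset-inside Ls x<L)) (trans eq (offset-beyond L Ls y′)))
  where
  open ≤-Reasoning
  crossing : x ≡ offset Ls y′ → s + x ≤ L + y′ × L + y′ + s ≤ L + sum Ls + x
  crossing x≡o with offset-blockStart Ls s≤Ls (+-cancelˡ-< L y′ (sum Ls) y<sum)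
  ... | b , b+o≡y′ , b+s≤ rewrite sym x≡o | sym b+o≡y′ =
    +-mono-≤ s≤L (m≤n+m x b) , (begin
      L + (b + x) + s   ≡⟨ +-assoc L (b + x) s ⟩
      L + (b + x + s)   ≡⟨ cong (L +_) (xy∙z≈xz∙y b x s) ⟩
      L + (b + s + x)   ≡⟨ +-assoc L (b + s) x ⟨
      L + (b + s) + x   ≤⟨ +-monoˡ-≤ x (+-monoʳ-≤ L b+s≤) ⟩
      L + sum Ls + x  ∎)
... | beyond x′ | beyond y′ =
  shift (≡offset⇒separated Ls s≤Ls (+-cancelˡ-< L x′ y′ x<y) (+-cancelˡ-< L y′ (sum Ls) y<sum)
          (trans (sym (offset-beyond L Ls x′)) (trans eq (offset-beyond L Ls y′))))
  where
  open ≤-Reasoning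
  shift : s + x′ ≤ y′ × y′ + s ≤ sum Ls + x′ →
          s + (L + x′) ≤ L + y′ × L + y′ + s ≤ L + sum Ls + (L + x′)
  shift (s+x′≤y′ , y′+s≤) =
    (begin
      s + (L + x′) ≡⟨ x∙yz≈y∙xz s L x′ ⟩
      L + (s + x′) ≤⟨ +-monoʳ-≤ L s+x′≤y′ ⟩
      L + y′       ∎) ,
    (begin
      L + y′ + s            ≡⟨ +-assoc L y′ s ⟩
      L + (y′ + s)          ≤⟨ +-monoʳ-≤ L y′+s≤ ⟩
      L + (sum Ls + x′)     ≡⟨ +-assoc L (sum Ls) x′ ⟨
      L + sum Ls + x′       ≤⟨ +-monoʳ-≤ (L + sum Ls) (m≤n+m x′ L) ⟩
      L + sum Ls + (L + x′) ∎)

separated⇒∣-∣-bounds : ∀ {s n x y} → s + x ≤ y → y + s ≤ n + x →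
  s ≤ ∣ x - y ∣ × ∣ x - y ∣ ≤ n ∸ s
separated⇒∣-∣-bounds {s} {n} {x} {y} s+x≤y y+s≤n+x
  rewrite m≤n⇒∣m-n∣≡n∸m (≤-trans (m≤n+m x s) s+x≤y) =
  m+n≤o⇒m≤o∸n s s+x≤y , m+n≤o⇒m≤o∸n (y ∸ x) (begin
    y ∸ x + s   ≡⟨ +-∸-comm s (≤-trans (m≤n+m x s) s+x≤y) ⟨
    y + s ∸ x   ≤⟨ ∸-monoˡ-≤ x y+s≤n+x ⟩
    n + x ∸ x   ≡⟨ m+n∸n≡m n x ⟩
    n           ∎)
  where open ≤-Reasoning

≡offset⇒∣-∣-bounds : ∀ {s} Ls {x y} → All (s ≤_) Ls → x < sum Ls → y < sum Ls → x ≢ y →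
  offset Ls x ≡ offset Ls y → s ≤ ∣ x - y ∣ × ∣ x - y ∣ ≤ sum Ls ∸ s
≡offset⇒∣-∣-bounds Ls {x} {y} s≤Ls x<sum y<sum x≢y eq with <-cmp x y
... | tri< x<y _ _ =
  Product.uncurry separated⇒∣-∣-bounds (≡offset⇒separated Ls s≤Ls x<y y<sum eq)
... | tri≈ _ x≡y _ = contradiction x≡y x≢y
... | tri> _ _ y<x rewrite ∣-∣-comm x y =
  Product.uncurry separated⇒∣-∣-bounds (≡offset⇒separated Ls s≤Ls y<x x<sum (sym eq))

BlockDecomposition : ℕ → ℕ → ℕ → Set
BlockDecomposition s r N = ∃ λ Ls → All (s ≤_) Ls × All (_≤ r) Ls × sum Ls ≡ N

blockDecomposition : ∀ {s r} → 0 < s → s ≤ r → s + s + s ≤ 1 + (r + r) → ∀ {N} → s + s ≤ N →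
  BlockDecomposition s r N
blockDecomposition {s} {r} 0<s s≤r 3s≤1+2r {N} = go N (<-wellFounded N)
  where
  go : ∀ N → Acc _<_ N → s + s ≤ N → BlockDecomposition s r N
  go N (acc smaller) 2s≤N with N ≤? r + r
  ... | yes N≤2r = ⌊ N /2⌋ ∷ ⌈ N /2⌉ ∷ [] ,
    s≤⌊N/2⌋ ∷ ≤-trans s≤⌊N/2⌋ (⌊n/2⌋≤⌈n/2⌉ N) ∷ [] ,
    ≤-trans (⌊n/2⌋≤⌈n/2⌉ N) ⌈N/2⌉≤r ∷ ⌈N/2⌉≤r ∷ [] ,
    trans (cong (⌊ N /2⌋ +_) (+-identityʳ ⌈ N /2⌉)) (⌊n/2⌋+⌈n/2⌉≡n N)
    where
    s≤⌊N/2⌋ : s ≤ ⌊ N /2⌋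
    s≤⌊N/2⌋ = subst (_≤ ⌊ N /2⌋) (sym (n≡⌊n+n/2⌋ s)) (⌊n/2⌋-mono 2s≤N)
    ⌈N/2⌉≤r : ⌈ N /2⌉ ≤ r
    ⌈N/2⌉≤r = subst (⌈ N /2⌉ ≤_) (sym (n≡⌈n+n/2⌉ r)) (⌈n/2⌉-mono N≤2r)
  ... | no N≰2r = prepend-s (go (N ∸ s) (smaller (∸-monoʳ-< 0<s s≤N)) (m+n≤o⇒m≤o∸n (s + s) 3s≤N))
    where
    3s≤N : s + s + s ≤ N
    3s≤N = ≤-trans 3s≤1+2r (≰⇒> N≰2r)
    s≤N : s ≤ N
    s≤N = ≤-trans (m≤m+n s (s + s)) (subst (_≤ N) (+-assoc s s s) 3s≤N)
    prepend-s : BlockDecomposition s r (N ∸ s) → BlockDecomposition s r N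
    prepend-s (Ls , s≤Ls , Ls≤r , sum≡N∸s) =
      s ∷ Ls , ≤-refl ∷ s≤Ls , s≤r ∷ Ls≤r , trans (cong (s +_) sum≡N∸s) (m+[n∸m]≡n s≤N)

stableColouring : ∀ {n s r} → 0 < s → s ≤ r → s + s + s ≤ 1 + (r + r) → s + s ≤ n →
  ∃ λ (colour : Fin n → Fin r) → ∀ e → Monochromatic colour e → IsStable n s e
stableColouring {s = s} {r} 0<s s≤r 3s≤1+2r 2s≤n with blockDecomposition 0<s s≤r 3s≤1+2r 2s≤n
... | Ls , s≤Ls , Ls≤r , refl = colour , stable
  where
  colour : Fin (sum Ls) → Fin r
  colour i = fromℕ< (offset-< Ls Ls≤r (toℕ<n i))
  stable : ∀ e → Monochromatic colour e → IsStable (sum Ls) s e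
  stable e mono i j i∈e j∈e i≢j =
    ≡offset⇒∣-∣-bounds Ls s≤Ls (toℕ<n i) (toℕ<n j) (λ i≡j → i≢j (toℕ-injective i≡j)) (begin
      offset Ls (toℕ i) ≡⟨ toℕ-fromℕ< _ ⟨
      toℕ (colour i)    ≡⟨ cong toℕ (mono i j i∈e j∈e) ⟩
      toℕ (colour j)    ≡⟨ toℕ-fromℕ< _ ⟩
      offset Ls (toℕ j) ∎)
    where open ≡-Reasoning

s+⌈s∸3/2⌉<r⇒3s≤1+2r : ∀ {s r} → 3 ≤ s → s + ⌈ (s ∸ 3) /2⌉ < r → s + s + s ≤ 1 + (r + r)
s+⌈s∸3/2⌉<r⇒3s≤1+2r {s} {r} (s≤s (s≤s (s≤s {n = t} _))) bound<r = begin
  s + s + (3 + t)                 ≡⟨ x∙yz≈y∙xz (s + s) 3 t ⟩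
  3 + (s + s + t)                 ≤⟨ +-monoʳ-≤ (3 + (s + s)) t≤c+c ⟩
  3 + (s + s + (c + c))           ≡⟨ cong (3 +_) (interchange s s c c) ⟩
  3 + (s + c + (s + c))           ≡⟨ cong (2 +_) (+-suc (s + c) (s + c)) ⟨
  1 + (suc (s + c) + suc (s + c)) ≤⟨ +-monoʳ-≤ 1 (+-mono-≤ bound<r bound<r) ⟩
  1 + (r + r)                     ∎
  where
  open ≤-Reasoning
  c = ⌈ t /2⌉
  t≤c+c : t ≤ c + c
  t≤c+c = subst (_≤ c + c) (⌊n/2⌋+⌈n/2⌉≡n t) (+-monoˡ-≤ c (⌊n/2⌋≤⌈n/2⌉ t))

ceilDivSuc-zero : ∀ b → ceilDivSuc 0 b ≡ 0
ceilDivSuc-zero b = m<n⇒m/n≡0 (n<1+n b)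

colourable⇒defect≡0 : ∀ {n r m} {H : Hypergraph n} → RemovalColorable r H ⊥ →
  ColorabilityDefect r H m → m ≡ 0
colourable⇒defect≡0 {n} colourable (_ , minimal) =
  n≤0⇒n≡0 (subst (_ ≤_) (∣⊥∣≡0 n) (minimal ⊥ colourable))

theorem1p11 : (n r s : ℕ) → 4 ≤ n → 4 ≤ r → 4 ≤ s → 2 * r ≤ n → s + 1 ≤ r →
    (∃ λ (H : Hypergraph n) → IsHypergraph H ×
      KGChromaticNumber r (stablePart s H) 0 ×
      (∃ λ (m : ℕ) → ColorabilityDefect r H m × ceilDivSuc m (r ∸ 2) ≡ 1)) →
    (s + 1 ≤ r) × (r ≤ s + ⌈ (s ∸ 3) /2⌉)
theorem1p11 n r s _ _ 4≤s 2r≤n s+1≤r (H , _ , ((kgColour , _) , _) , m , defect , ⌈m/r-1⌉≡1) =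
  s+1≤r , ≮⇒≥ bound≮r
  where
  s≤r : s ≤ r
  s≤r = ≤-trans (m≤m+n s 1) s+1≤r
  2s≤n : s + s ≤ n
  2s≤n = ≤-trans (+-mono-≤ s≤r s≤r) (subst (_≤ n) (cong (r +_) (+-identityʳ r)) 2r≤n)
  bound≮r : ¬ (s + ⌈ (s ∸ 3) /2⌉ < r)
  bound≮r bound<r = contradiction (trans (sym ⌈m/r-1⌉≡1) ⌈m/r-1⌉≡0) λ ()
    where
    colouring : ∃ λ (colour : Fin n → Fin r) → ∀ e → Monochromatic colour e → IsStable n s e
    colouring = stableColouring (≤-trans (s≤s z≤n) 4≤s) s≤r
                  (s+⌈s∸3/2⌉<r⇒3s≤1+2r (≤-trans (n≤1+n 3) 4≤s) bound<r) 2s≤n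
    colourable : RemovalColorable r H ⊥
    colourable = proj₁ colouring ,
      λ e e∈H _ mono → ¬Fin0 (kgColour (e , e∈H , proj₂ colouring e mono))
    ⌈m/r-1⌉≡0 : ceilDivSuc m (r ∸ 2) ≡ 0
    ⌈m/r-1⌉≡0 rewrite colourable⇒defect≡0 colourable defect = ceilDivSuc-zero (r ∸ 2)
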